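{- Let $G$ be a graph with a cofinite free $\mathbb Z^d$-symmetry, and let $G_1, \ldots, G_t$ be its component orbits (each $G_k$ is the union of the $\mathbb Z^d$-translates of a connected component of $G$, itself a graph with cofinite free $\mathbb Z^d$-symmetry). Then, up to multiplication by units of $\mathbb Z[x_1^{\pm1},\ldots,x_d^{\pm1}]$, $\Delta(G) = \Delta(G_1)\cdots \Delta(G_t)$.
   Context: Regard $\mathbb Z^d$ as the multiplicative free abelian group on $x_1,\ldots,x_d$, writing $x^{\mathbf s}=x_1^{s_1}\cdots x_d^{s_d}$ for $\mathbf s\in\mathbb Z^d$, and let $\mathcal R_d=\mathbb Z[x_1^{\pm1},\ldots,x_d^{\pm1}]$. A graph $G=(V,E)$ (multiple edges and loops allowed) has a cofinite free $\mathbb Z^d$-symmetry if $\mathbb Z^d$ acts freely on its vertices and edges by graph automorphisms with finite quotient graph $\overline G$. Then $V$ is a finite union of orbits $\{v_{i,\mathbf s}:\mathbf s\in\mathbb Z^d\}$, $i=1,\ldots,n$, with $x^{\mathbf s'}\cdot v_{i,\mathbf s}=v_{i,\mathbf s+\mathbf s'}$. The Laplacian matrix of $G$ is the $n\times n$ matrix $L=D-A$ over $\mathcal R_d$, where $D$ is diagonal with $D_{ii}$ the degree of $v_{i,\mathbf 0}$, and $A_{ij}$ is the sum, over all edges of $G$ joining $v_{i,\mathbf 0}$ to some $v_{j,\mathbf s}$, of the monomial $x^{\mathbf s}$ (loops are ignored). The Laplacian polynomial is $\Delta(G)=\det L$, well defined up to multiplication by units of $\mathcal R_d$. -}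

module Defs where

open import Data.Nat as ℕ using (ℕ; zero; suc)
open import Data.Integer as ℤ using (ℤ; +_; -_)
open import Data.Fin as Fin using (Fin; zero; suc; punchIn)
open import Data.Fin.Properties using () renaming (_≟_ to _≟F_)
open import Data.Vec as Vec using (Vec; replicate; zipWith)
open import Data.Vec.Properties using (≡-dec)
open import Data.List as List using (List; []; _∷_; _++_; filterᵇ; length; lookup; allFin; concatMap; foldr)
open import Data.Bool using (Bool; true; false; _∧_; if_then_else_)
open import Data.Product using (Σ; ∃; _×_; _,_)
open import Relation.Nullary using (does)
open import Relation.Binary.PropositionalEquality using (_≡_)
open import Function.Bundles using (_⇔_)
open import Data.List.Membership.Propositional using (_∈_)
open import Data.List.Relation.Unary.All using (All)

-- Exponent vectors: ℤ^d written additively (x^s ↔ s).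

Exp : ℕ → Set
Exp d = Vec ℤ d

0ᵉ : ∀ {d} → Exp d
0ᵉ = replicate _ (+ 0)

_+ᵉ_ : ∀ {d} → Exp d → Exp d → Exp d
_+ᵉ_ = zipWith ℤ._+_

-ᵉ_ : ∀ {d} → Exp d → Exp d
-ᵉ_ = Vec.map -_

_≟ᵉ_ : ∀ {d} (s t : Exp d) → _
_≟ᵉ_ = ≡-dec ℤ._≟_

-- Laurent polynomials R_d = ℤ[x₁^{±1},…,x_d^{±1}]:
-- formal finite sums of terms c·x^s, with equality of coefficients.

LP : ℕ → Set
LP d = List (ℤ × Exp d)

coeff : ∀ {d} → LP d → Exp d → ℤ
coeff [] s = + 0
coeff ((c , e) ∷ p) s = (if does (e ≟ᵉ s) then c else + 0) ℤ.+ coeff p s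

infix 4 _≈_
_≈_ : ∀ {d} → LP d → LP d → Set
p ≈ q = ∀ s → coeff p s ≡ coeff q s

0ᴸ : ∀ {d} → LP d
0ᴸ = []

const : ∀ {d} → ℤ → LP d
const c = (c , 0ᵉ) ∷ []

1ᴸ : ∀ {d} → LP d
1ᴸ = const (+ 1)

mono : ∀ {d} → Exp d → LP d
mono s = (+ 1 , s) ∷ []

infixl 6 _+ᴸ_
_+ᴸ_ : ∀ {d} → LP d → LP d → LP d
_+ᴸ_ = _++_

negᴸ : ∀ {d} → LP d → LP d
negᴸ = List.map (λ { (c , e) → (- c , e) })

infixl 7 _*ᴸ_
_*ᴸ_ : ∀ {d} → LP d → LP d → LP d
p *ᴸ q = concatMap (λ { (c , e) → List.map (λ { (c' , e') → (c ℤ.* c' , e +ᵉ e') }) q }) p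

productᴸ : ∀ {d} → List (LP d) → LP d
productᴸ = foldr _*ᴸ_ 1ᴸ

IsUnit : ∀ {d} → LP d → Set
IsUnit u = Σ _ λ v → u *ᴸ v ≈ 1ᴸ

altSum : ∀ {d k} → (Fin k → LP d) → LP d
altSum {k = zero} f = 0ᴸ
altSum {k = suc k} f = f zero +ᴸ negᴸ (altSum (λ j → f (suc j)))

det : ∀ {d n} → (Fin n → Fin n → LP d) → LP d
det {n = zero} M = 1ᴸ
det {n = suc n} M =
  altSum (λ j → M zero j *ᴸ det (λ r c → M (suc r) (punchIn j c)))

-- Graphs with a cofinite free ℤ^d-symmetry, given by quotient data:
-- vertex orbits v_{i,s} (i : Fin n, s ∈ ℤ^d) and a finite list of edge
-- orbits (a , b , s): the edge orbit {v_{a,t} — v_{b,t+s} : t ∈ ℤ^d}.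

EdgeOrbit : ℕ → ℕ → Set
EdgeOrbit d n = Fin n × Fin n × Exp d

record PGraph (d : ℕ) : Set where
  field
    n     : ℕ
    edges : List (EdgeOrbit d n)
open PGraph public

isLoop : ∀ {d n} → EdgeOrbit d n → Bool
isLoop (a , b , s) = does (a ≟F b) ∧ does (s ≟ᵉ 0ᵉ)

eqF : ∀ {n} → Fin n → Fin n → Bool
eqF i j = does (i ≟F j)

degree : ∀ {d n} → List (EdgeOrbit d n) → Fin n → ℤ
degree [] i = + 0
degree (e@(a , b , s) ∷ es) i =
  (if isLoop e then + 0
   else (if eqF a i then + 1 else + 0) ℤ.+ (if eqF b i then + 1 else + 0))
  ℤ.+ degree es i

-- A_{ij}: sum of x^s over edges joining v_{i,0} to v_{j,s} (loops ignored).
adj : ∀ {d n} → List (EdgeOrbit d n) → Fin n → Fin n → LP d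
adj [] i j = 0ᴸ
adj (e@(a , b , s) ∷ es) i j =
  (if isLoop e then 0ᴸ
   else ((if eqF a i ∧ eqF b j then mono s else 0ᴸ)
         +ᴸ (if eqF b i ∧ eqF a j then mono (-ᵉ s) else 0ᴸ)))
  +ᴸ adj es i j

-- Laplacian D - A with respect to an ordering idx : Fin m → Fin n of
-- the vertex orbits under consideration.
laplacianOn : ∀ {d n} → List (EdgeOrbit d n) → (m : ℕ) → (Fin m → Fin n)
            → Fin m → Fin m → LP d
laplacianOn es m idx p q =
  (if eqF p q then const (degree es (idx p)) else 0ᴸ)
  +ᴸ negᴸ (adj es (idx p) (idx q))

Δ : ∀ {d} → PGraph d → LP d
Δ G = det (laplacianOn (edges G) (n G) (λ i → i))

-- Connectivity in the (infinite) graph G, vertices (i , s) = v_{i,s}.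

data Adjacent {d} (G : PGraph d) : Fin (n G) × Exp d → Fin (n G) × Exp d → Set where
  fwd : ∀ {a b s} t → (a , b , s) ∈ edges G →
        Adjacent G (a , t) (b , t +ᵉ s)
  bwd : ∀ {a b s} t → (a , b , s) ∈ edges G →
        Adjacent G (b , t +ᵉ s) (a , t)

data Reach {d} (G : PGraph d) : Fin (n G) × Exp d → Fin (n G) × Exp d → Set where
  here  : ∀ {v} → Reach G v v
  there : ∀ {u v w} → Adjacent G u v → Reach G v w → Reach G u w

Subset : ℕ → Set
Subset n = Fin n → Bool

-- S is (the set of vertex orbits of) a component orbit of G: the union of
-- the ℤ^d-translates of the connected component of some vertex v_{i,0}.
IsComponentOrbit : ∀ {d} (G : PGraph d) → Subset (n G) → Set
IsComponentOrbit G S =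
  Σ (Fin (n G)) λ i → ∀ j → (S j ≡ true) ⇔ (∃ λ s → Reach G (i , 0ᵉ) (j , s))

IsComponentOrbitList : ∀ {d} (G : PGraph d) → List (Subset (n G)) → Set
IsComponentOrbitList G Ss =
  All (IsComponentOrbit G) Ss ×
  (∀ i → length (filterᵇ (λ S → S i) Ss) ≡ 1)

-- Δ of the subgraph G_S of G spanned by the vertex orbits in S (with all
-- edges of G between them); its vertex orbits are the i with S i = true,
-- ordered increasingly (idx enumerates them).
ΔSub : ∀ {d} (G : PGraph d) → Subset (n G) → LP d
ΔSub {d} G S = det (laplacianOn es (length vs) (lookup vs))
  where
  vs : List (Fin (n G))
  vs = filterᵇ S (allFin (n G))
  es : List (EdgeOrbit d (n G))
  es = filterᵇ (λ { (a , b , s) → S a ∧ S b }) (edges G)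

module Submission where

-- A component orbit S is closed under edges, so the Laplacian
-- L = D - A of G has no entries between S and its complement, and the
-- S-block of L is exactly the Laplacian of the subgraph G_S.  Hence L is
-- block diagonal for the partition of the vertex orbits into component
-- orbits, and its determinant is the product of the block determinants:
-- the identity holds on the nose, with unit 1.

open import Data.List using (List; map)
open import Data.Product using (Σ; _×_; _,_)

-- Determinants of block-diagonal matrices over a commutative ring.
module BlockDeterminants where

  open import Level using (_⊔_)
  open import Data.Nat as ℕ using (ℕ; zero; suc)
  import Data.Nat.Properties as ℕ
  open import Data.Nat.Tactic.RingSolver using (solve-∀)
  open import Data.List using (List; []; _∷_; _++_; length; filterᵇ; map; foldr)
  import Data.List.Properties as List
  open import Data.Bool using (Bool; true; false; not; if_then_else_; T; T?)
  open import Data.Bool.Properties using (not-involutive; T-≡; T-not-≡)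
  open import Data.Product using (_×_; _,_; proj₁; proj₂)
  open import Function using (_∘_; Equivalence)
  open import Relation.Nullary using (contradiction)
  open import Data.List.Membership.Propositional using (_∈_; lose)
  open import Data.List.Relation.Unary.All as All using (All; []; _∷_)
  import Data.List.Relation.Unary.All.Properties as All
  open import Relation.Binary.PropositionalEquality as ≡ using (_≡_; _≢_; cong; cong₂)

  module _ {a} {A : Set a} where

    ∁ᵇ : (A → Bool) → A → Bool
    ∁ᵇ c = not ∘ c

    filterᵇ-accept : ∀ (c : A → Bool) {x} xs → c x ≡ true → filterᵇ c (x ∷ xs) ≡ x ∷ filterᵇ c xs
    filterᵇ-accept c xs cx rewrite cx = ≡.refl

    filterᵇ-reject : ∀ (c : A → Bool) {x} xs → c x ≡ false → filterᵇ c (x ∷ xs) ≡ filterᵇ c xs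
    filterᵇ-reject c xs cx rewrite cx = ≡.refl

    filterᵇ-∁ᵇ-∁ᵇ : ∀ (c : A → Bool) xs → filterᵇ (∁ᵇ (∁ᵇ c)) xs ≡ filterᵇ c xs
    filterᵇ-∁ᵇ-∁ᵇ c = List.filter-≐ (T? ∘ ∁ᵇ (∁ᵇ c)) (T? ∘ c)
      ((λ {x} → ≡.subst T (not-involutive (c x))) , (λ {x} → ≡.subst T (≡.sym (not-involutive (c x)))))

    count : (A → Bool) → List A → ℕ
    count c xs = length (filterᵇ c xs)

    -- number of pairs (x before y) in xs with x outside and y inside c:
    -- the inversions of the stable partition of xs into its c-part and the rest
    inversions : (A → Bool) → List A → ℕ
    inversions c []       = 0
    inversions c (x ∷ xs) = (if c x then 0 else count c xs) ℕ.+ inversions c xs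

    count-complement : ∀ (c : A → Bool) xs → count c xs ℕ.+ count (∁ᵇ c) xs ≡ length xs
    count-complement c []       = ≡.refl
    count-complement c (x ∷ xs) with c x
    ... | true  = cong suc (count-complement c xs)
    ... | false = ≡.trans (ℕ.+-suc _ _) (cong suc (count-complement c xs))

    count-∁ᵇ : ∀ (c : A → Bool) xs ys → length xs ≡ length ys → count c xs ≡ count c ys →
               count (∁ᵇ c) xs ≡ count (∁ᵇ c) ys
    count-∁ᵇ c xs ys len cnt = ℕ.+-cancelˡ-≡ (count c xs) _ _ (begin
      count c xs ℕ.+ count (∁ᵇ c) xs  ≡⟨ count-complement c xs ⟩
      length xs                       ≡⟨ len ⟩
      length ys                       ≡⟨ count-complement c ys ⟨
      count c ys ℕ.+ count (∁ᵇ c) ys  ≡⟨ cong (ℕ._+ count (∁ᵇ c) ys) cnt ⟨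
      count c xs ℕ.+ count (∁ᵇ c) ys  ∎)
      where open ≡.≡-Reasoning

    -- every pair (outside, inside) is an inversion for c or for its complement
    inversions-complement : ∀ (c : A → Bool) xs →
      inversions c xs ℕ.+ inversions (∁ᵇ c) xs ≡ count c xs ℕ.* count (∁ᵇ c) xs
    inversions-complement c []       = ≡.refl
    inversions-complement c (x ∷ xs) with c x
    ... | true  = ≡.trans (regroup (inversions c xs) (count (∁ᵇ c) xs) (inversions (∁ᵇ c) xs))
                          (cong (count (∁ᵇ c) xs ℕ.+_) (inversions-complement c xs))
      where
      regroup : ∀ i f i' → i ℕ.+ (f ℕ.+ i') ≡ f ℕ.+ (i ℕ.+ i')
      regroup = solve-∀
    ... | false = ≡.trans (ℕ.+-assoc (count c xs) (inversions c xs) (inversions (∁ᵇ c) xs))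
                  (≡.trans (cong (count c xs ℕ.+_) (inversions-complement c xs))
                           (≡.sym (ℕ.*-suc (count c xs) (count (∁ᵇ c) xs))))

    filterᵇ-insert-reject : ∀ (c : A → Bool) {x} pre xs → c x ≡ false →
                            filterᵇ c (pre ++ x ∷ xs) ≡ filterᵇ c (pre ++ xs)
    filterᵇ-insert-reject c {x} pre xs cx = begin
      filterᵇ c (pre ++ x ∷ xs)           ≡⟨ List.filter-++ (T? ∘ c) pre (x ∷ xs) ⟩
      filterᵇ c pre ++ filterᵇ c (x ∷ xs) ≡⟨ cong (filterᵇ c pre ++_) (filterᵇ-reject c xs cx) ⟩
      filterᵇ c pre ++ filterᵇ c xs       ≡⟨ List.filter-++ (T? ∘ c) pre xs ⟨
      filterᵇ c (pre ++ xs)               ∎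
      where open ≡.≡-Reasoning

    count-insert : ∀ (c : A → Bool) {x} pre xs → c x ≡ true →
                   count c (pre ++ x ∷ xs) ≡ suc (count c (pre ++ xs))
    count-insert c {x} pre xs cx = begin
      length (filterᵇ c (pre ++ x ∷ xs))            ≡⟨ cong length (List.filter-++ (T? ∘ c) pre (x ∷ xs)) ⟩
      length (filterᵇ c pre ++ filterᵇ c (x ∷ xs))  ≡⟨ cong (λ ys → length (filterᵇ c pre ++ ys))
                                                            (filterᵇ-accept c xs cx) ⟩
      length (filterᵇ c pre ++ x ∷ filterᵇ c xs)    ≡⟨ List.length-++-sucʳ (filterᵇ c pre) x (filterᵇ c xs) ⟩
      suc (length (filterᵇ c pre ++ filterᵇ c xs))  ≡⟨ cong (suc ∘ length) (List.filter-++ (T? ∘ c) pre xs) ⟨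
      suc (length (filterᵇ c (pre ++ xs)))          ∎
      where open ≡.≡-Reasoning

    inversions-insert : ∀ (c : A → Bool) {x} pre xs → c x ≡ true →
      inversions c (pre ++ x ∷ xs) ≡ inversions c (pre ++ xs) ℕ.+ count (∁ᵇ c) pre
    inversions-insert c []      xs cx rewrite cx = ≡.sym (ℕ.+-identityʳ _)
    inversions-insert c (y ∷ pre) xs cx with c y
    ... | true  = inversions-insert c pre xs cx
    ... | false rewrite count-insert c pre xs cx | inversions-insert c pre xs cx =
      regroup (count c (pre ++ xs)) (inversions c (pre ++ xs)) (count (∁ᵇ c) pre)
      where
      regroup : ∀ k i f → suc k ℕ.+ (i ℕ.+ f) ≡ k ℕ.+ i ℕ.+ suc f
      regroup = solve-∀

    filterᵇ-snoc-accept : ∀ (c : A → Bool) {x} pre → c x ≡ true →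
                          filterᵇ c (pre ++ x ∷ []) ≡ filterᵇ c pre ++ x ∷ []
    filterᵇ-snoc-accept c pre cx =
      ≡.trans (List.filter-++ (T? ∘ c) pre _) (cong (filterᵇ c pre ++_) (filterᵇ-accept c [] cx))

    filterᵇ-snoc-reject : ∀ (c : A → Bool) {x} pre → c x ≡ false →
                          filterᵇ c (pre ++ x ∷ []) ≡ filterᵇ c pre
    filterᵇ-snoc-reject c pre cx =
      ≡.trans (filterᵇ-insert-reject c pre [] cx) (cong (filterᵇ c) (List.++-identityʳ pre))

  module _ {a} {A : Set a} where

    InExactlyOne : List (A → Bool) → A → Set
    InExactlyOne Ss x = count (λ S → S x) Ss ≡ 1

    inExactlyOne-∈ : ∀ S Ss {S′ x} → InExactlyOne (S ∷ Ss) x → S′ ∈ Ss → S′ x ≡ true → S x ≡ false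
    inExactlyOne-∈ S Ss {S′} {x} one S′∈Ss S′x = by-S (S x) ≡.refl
      where
      by-S : ∀ b → S x ≡ b → S x ≡ false
      by-S false Sx = Sx
      by-S true  Sx = contradiction
        (ℕ.suc-injective (≡.trans (≡.sym (cong length (filterᵇ-accept (λ T → T x) {S} Ss Sx))) one))
        (ℕ.>⇒≢ (List.filter-some (T? ∘ λ S → S x) (lose S′∈Ss (Equivalence.from T-≡ S′x))))

    inExactlyOne-∷ : ∀ S Ss {x} → InExactlyOne (S ∷ Ss) x → S x ≡ false → InExactlyOne Ss x
    inExactlyOne-∷ S Ss {x} one Sx = ≡.trans (≡.sym (cong length (filterᵇ-reject (λ T → T x) {S} Ss Sx))) one

    filterᵇ-∁ᵇ-disjoint : ∀ (S S′ : A → Bool) xs → All (λ x → S′ x ≡ true → S x ≡ false) xs →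
                          filterᵇ S′ (filterᵇ (∁ᵇ S) xs) ≡ filterᵇ S′ xs
    filterᵇ-∁ᵇ-disjoint S S′ []       []          = ≡.refl
    filterᵇ-∁ᵇ-disjoint S S′ (x ∷ xs) (dis ∷ diss) with S x
    ... | true  with S′ x
    ...   | true  with () ← dis ≡.refl
    ...   | false = filterᵇ-∁ᵇ-disjoint S S′ xs diss
    filterᵇ-∁ᵇ-disjoint S S′ (x ∷ xs) (dis ∷ diss) | false with S′ x
    ...   | true  = cong (x ∷_) (filterᵇ-∁ᵇ-disjoint S S′ xs diss)
    ...   | false = filterᵇ-∁ᵇ-disjoint S S′ xs diss

    inExactlyOne-rest : ∀ S Ss xs → All (InExactlyOne (S ∷ Ss)) xs → All (InExactlyOne Ss) (filterᵇ (∁ᵇ S) xs)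
    inExactlyOne-rest S Ss xs one =
      All.map (λ (one-x , ¬Sx) → inExactlyOne-∷ S Ss one-x (Equivalence.to T-not-≡ ¬Sx))
              (All.zip (All.filter⁺ (T? ∘ ∁ᵇ S) one , All.all-filter (T? ∘ ∁ᵇ S) xs))

  open import Algebra.Bundles using (CommutativeRing)

  module Determinant {r ℓ} (R : CommutativeRing r ℓ) where
    open CommutativeRing R
    open import Algebra.Properties.Ring ring using (-‿distribˡ-*; -‿distribʳ-*; -‿involutive)
    open import Relation.Binary.Reasoning.Setoid setoid

    sign : ℕ → Carrier
    sign zero    = 1#
    sign (suc n) = - sign n

    sign-+ : ∀ a b → sign (a ℕ.+ b) ≈ sign a * sign b
    sign-+ zero    b = sym (*-identityˡ (sign b))
    sign-+ (suc a) b = trans (-‿cong (sign-+ a b)) (-‿distribˡ-* (sign a) (sign b))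

    sign-square : ∀ m → sign m * sign m ≈ 1#
    sign-square zero    = *-identityˡ 1#
    sign-square (suc m) = begin
      - sign m * - sign m     ≈⟨ -‿distribˡ-* (sign m) (- sign m) ⟨
      - (sign m * - sign m)   ≈⟨ -‿cong (-‿distribʳ-* (sign m) (sign m)) ⟨
      - - (sign m * sign m)   ≈⟨ -‿involutive _ ⟩
      sign m * sign m         ≈⟨ sign-square m ⟩
      1#                      ∎

    sign-even : ∀ a m → sign (a ℕ.+ (m ℕ.+ m)) ≈ sign a
    sign-even a m = begin
      sign (a ℕ.+ (m ℕ.+ m))  ≈⟨ sign-+ a (m ℕ.+ m) ⟩
      sign a * sign (m ℕ.+ m) ≈⟨ *-congˡ (trans (sign-+ m m) (sign-square m)) ⟩
      sign a * 1#             ≈⟨ *-identityʳ (sign a) ⟩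
      sign a                  ∎

    sign-swap : ∀ a a' b b' → a ℕ.+ a' ≡ b ℕ.+ b' → sign (a' ℕ.+ b') ≈ sign (a ℕ.+ b)
    sign-swap a a' b b' eq = begin
      sign (a' ℕ.+ b')                                    ≈⟨ sign-even (a' ℕ.+ b') (a ℕ.+ b) ⟨
      sign ((a' ℕ.+ b') ℕ.+ ((a ℕ.+ b) ℕ.+ (a ℕ.+ b)))   ≡⟨ cong sign (regroup a a' b b') ⟩
      sign ((a ℕ.+ b) ℕ.+ ((a ℕ.+ a') ℕ.+ (b ℕ.+ b')))   ≡⟨ cong (λ k → sign ((a ℕ.+ b) ℕ.+ ((a ℕ.+ a') ℕ.+ k))) (≡.sym eq) ⟩
      sign ((a ℕ.+ b) ℕ.+ ((a ℕ.+ a') ℕ.+ (a ℕ.+ a')))   ≈⟨ sign-even (a ℕ.+ b) (a ℕ.+ a') ⟩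
      sign (a ℕ.+ b)                                      ∎
      where
      regroup : ∀ a a' b b' → (a' ℕ.+ b') ℕ.+ ((a ℕ.+ b) ℕ.+ (a ℕ.+ b)) ≡ (a ℕ.+ b) ℕ.+ ((a ℕ.+ a') ℕ.+ (b ℕ.+ b'))
      regroup = solve-∀

    factor-common : ∀ Y s X Z Q → Y * (s * (X * Z)) + - (s * (Q * Z)) ≈ s * ((Y * X + - Q) * Z)
    factor-common Y s X Z Q = sym (begin
      s * ((Y * X + - Q) * Z)                   ≈⟨ *-congˡ (distribʳ Z (Y * X) (- Q)) ⟩
      s * ((Y * X) * Z + - Q * Z)               ≈⟨ distribˡ s _ _ ⟩
      s * ((Y * X) * Z) + s * (- Q * Z)         ≈⟨ +-cong move-Y move-neg ⟩
      Y * (s * (X * Z)) + - (s * (Q * Z))       ∎)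
      where
      move-Y : s * ((Y * X) * Z) ≈ Y * (s * (X * Z))
      move-Y = begin
        s * ((Y * X) * Z)   ≈⟨ *-congˡ (*-assoc Y X Z) ⟩
        s * (Y * (X * Z))   ≈⟨ *-assoc s Y (X * Z) ⟨
        (s * Y) * (X * Z)   ≈⟨ *-congʳ (*-comm s Y) ⟩
        (Y * s) * (X * Z)   ≈⟨ *-assoc Y s (X * Z) ⟩
        Y * (s * (X * Z))   ∎
      move-neg : s * (- Q * Z) ≈ - (s * (Q * Z))
      move-neg = trans (*-congˡ (sym (-‿distribˡ-* Q Z))) (sym (-‿distribʳ-* s (Q * Z)))

    vanishing-first-term : ∀ W s V → 0# * W + - (- s * V) ≈ s * V
    vanishing-first-term W s V = begin
      0# * W + - (- s * V)      ≈⟨ +-cong (zeroˡ W) (-‿cong (sym (-‿distribˡ-* s V))) ⟩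
      0# + - - (s * V)          ≈⟨ +-identityˡ _ ⟩
      - - (s * V)               ≈⟨ -‿involutive _ ⟩
      s * V                     ∎

    product-cong : ∀ {a} {A : Set a} {f g : A → Carrier} xs → All (λ x → f x ≈ g x) xs →
                   foldr _*_ 1# (map f xs) ≈ foldr _*_ 1# (map g xs)
    product-cong []       []           = refl
    product-cong (x ∷ xs) (fx≈gx ∷ eqs) = *-cong fx≈gx (product-cong xs eqs)

    picks : ∀ {a} {A : Set a} → List A → List (A × List A)
    picks []       = []
    picks (x ∷ xs) = (x , xs) ∷ map (λ pr → proj₁ pr , x ∷ proj₂ pr) (picks xs)

    alternatingSum : List Carrier → Carrier
    alternatingSum []       = 0#
    alternatingSum (x ∷ xs) = x + - alternatingSum xs

    module Expansion {a} {A : Set a} (M : A → A → Carrier) where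

      -- det of the submatrix of M with rows rs and columns cs (in order)
      detL : List A → List A → Carrier
      detL []       cs = 1#
      detL (r ∷ rs) cs = alternatingSum (map (λ pr → M r (proj₁ pr) * detL rs (proj₂ pr)) (picks cs))

      -- expansion along row r, where the minor of column x is D applied to
      -- pre followed by the remaining columns; detL (r ∷ rs) = expandRow r (detL rs) []
      expandRow : A → (List A → Carrier) → List A → List A → Carrier
      expandRow r D pre cs = alternatingSum (map (λ pr → M r (proj₁ pr) * D (pre ++ proj₂ pr)) (picks cs))

      expandRow-∷ : ∀ r D pre x xs →
        expandRow r D pre (x ∷ xs) ≡ M r x * D (pre ++ xs) + - expandRow r D (pre ++ x ∷ []) xs
      expandRow-∷ r D pre x xs = cong (λ ms → M r x * D (pre ++ xs) + - alternatingSum ms)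
        (≡.trans (≡.sym (List.map-∘ (picks xs)))
                 (List.map-cong (λ pr → cong (λ cs → M r (proj₁ pr) * D cs)
                                             (≡.sym (List.++-assoc pre (x ∷ []) (proj₂ pr))))
                                (picks xs)))

      BlockDiagonal : (A → Bool) → Set (a ⊔ ℓ)
      BlockDiagonal c = ∀ x y → c x ≢ c y → M x y ≈ 0#

      -- the determinant factorises into the c-block and the complementary
      -- block, up to the sign of the permutations sorting rows and columns
      Factorises : (A → Bool) → List A → List A → Set ℓ
      Factorises c rs cs =
        detL rs cs ≈ sign (inversions c rs ℕ.+ inversions c cs) *
                     (detL (filterᵇ c rs) (filterᵇ c cs) * detL (filterᵇ (∁ᵇ c) rs) (filterᵇ (∁ᵇ c) cs))

      -- The columns
      -- are processed one at a time; pre holds the columns already passed.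
      -- Columns outside c contribute nothing (M r x ≈ 0) but flip the sign
      -- of the later terms, which is recorded by count (∁ᵇ c) pre.
      module InsideRow (c : A → Bool) (block : BlockDiagonal c) (r : A) (cr : c r ≡ true)
                       (rs : List A)
                       (ih : ∀ cs → length rs ≡ length cs → count c rs ≡ count c cs → Factorises c rs cs) where

        inside outside : List A → List A
        inside  = filterᵇ c
        outside = filterᵇ (∁ᵇ c)

        exponent : List A → List A → ℕ
        exponent pre cs = inversions c rs ℕ.+ inversions c (pre ++ cs) ℕ.+ count (∁ᵇ c) pre

        outerMinor : List A → List A → Carrier
        outerMinor pre cs = detL (outside rs) (outside (pre ++ cs))

        Expanded : List A → List A → Set ℓ
        Expanded pre cs = expandRow r (detL rs) pre cs ≈
          sign (exponent pre cs) * (expandRow r (detL (inside rs)) (inside pre) (inside cs) * outerMinor pre cs)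

        reassoc : ∀ (pre : List A) x xs → (pre ++ x ∷ []) ++ xs ≡ pre ++ x ∷ xs
        reassoc pre x xs = List.++-assoc pre (x ∷ []) xs

        outerMinor-snoc : ∀ pre (x : A) xs → outerMinor (pre ++ x ∷ []) xs ≡ outerMinor pre (x ∷ xs)
        outerMinor-snoc pre x xs = cong (detL (outside rs) ∘ outside) (reassoc pre x xs)

        exponent-snoc-inside : ∀ pre {x} xs → c x ≡ true → exponent (pre ++ x ∷ []) xs ≡ exponent pre (x ∷ xs)
        exponent-snoc-inside pre {x} xs cx =
          cong₂ (λ (i : List A) f → inversions c rs ℕ.+ inversions c i ℕ.+ f)
                (reassoc pre x xs) (cong length (filterᵇ-snoc-reject (∁ᵇ c) pre (cong not cx)))

        exponent-snoc-outside : ∀ pre {x} xs → c x ≡ false → exponent (pre ++ x ∷ []) xs ≡ suc (exponent pre (x ∷ xs))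
        exponent-snoc-outside pre {x} xs cx = ≡.trans
          (cong₂ (λ (i : List A) f → inversions c rs ℕ.+ inversions c i ℕ.+ f) (reassoc pre x xs) count-snoc)
          (ℕ.+-suc _ (count (∁ᵇ c) pre))
          where
          count-snoc : count (∁ᵇ c) (pre ++ x ∷ []) ≡ suc (count (∁ᵇ c) pre)
          count-snoc = ≡.trans (cong length (filterᵇ-snoc-accept (∁ᵇ c) pre (cong not cx)))
                               (≡.trans (List.length-++ (outside pre)) (ℕ.+-comm _ 1))

        -- the sign produced by the inductive hypothesis for the minor of an
        -- inside column x differs from that of the expansion by an even amount
        exponent-minor : ∀ pre {x} xs → c x ≡ true →
          sign (inversions c rs ℕ.+ inversions c (pre ++ xs)) ≈ sign (exponent pre (x ∷ xs))
        exponent-minor pre {x} xs cx = begin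
          sign (I ℕ.+ J)                    ≈⟨ sign-even (I ℕ.+ J) F ⟨
          sign (I ℕ.+ J ℕ.+ (F ℕ.+ F))      ≡⟨ cong sign (regroup I J F) ⟩
          sign (I ℕ.+ (J ℕ.+ F) ℕ.+ F)      ≡⟨ cong (λ k → sign (I ℕ.+ k ℕ.+ F)) (inversions-insert c pre xs cx) ⟨
          sign (exponent pre (x ∷ xs))      ∎
          where
          I = inversions c rs
          J = inversions c (pre ++ xs)
          F = count (∁ᵇ c) pre
          regroup : ∀ i j f → i ℕ.+ j ℕ.+ (f ℕ.+ f) ≡ i ℕ.+ (j ℕ.+ f) ℕ.+ f
          regroup = solve-∀

        expanded-[] : ∀ pre → Expanded pre []
        expanded-[] pre = sym (trans (*-congˡ (zeroˡ _)) (zeroʳ _))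

        expanded-inside : ∀ pre {x} xs → c x ≡ true →
          length rs ≡ length (pre ++ xs) → count c rs ≡ count c (pre ++ xs) →
          Expanded (pre ++ x ∷ []) xs → Expanded pre (x ∷ xs)
        expanded-inside pre {x} xs cx len cnt later = begin
          expandRow r (detL rs) pre (x ∷ xs)
            ≡⟨ expandRow-∷ r (detL rs) pre x xs ⟩
          M r x * detL rs (pre ++ xs) + - expandRow r (detL rs) (pre ++ x ∷ []) xs
            ≈⟨ +-cong (*-congˡ minor) (-‿cong later′) ⟩
          M r x * (s * (X * Z)) + - (s * (Q * Z))
            ≈⟨ factor-common (M r x) s X Z Q ⟩
          s * ((M r x * X + - Q) * Z)
            ≡⟨ cong (λ e → s * (e * Z)) (≡.sym (expandRow-∷ r D (inside pre) x (inside xs))) ⟩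
          s * (expandRow r D (inside pre) (x ∷ inside xs) * Z)
            ≡⟨ cong (λ cs → s * (expandRow r D (inside pre) cs * Z)) (≡.sym (filterᵇ-accept c xs cx)) ⟩
          s * (expandRow r D (inside pre) (inside (x ∷ xs)) * Z)
            ∎
          where
          D = detL (inside rs)
          s = sign (exponent pre (x ∷ xs))
          X = D (inside pre ++ inside xs)
          Q = expandRow r D (inside pre ++ x ∷ []) (inside xs)
          Z = outerMinor pre (x ∷ xs)
          minor : detL rs (pre ++ xs) ≈ s * (X * Z)
          minor = trans (ih (pre ++ xs) len cnt)
            (*-cong (exponent-minor pre xs cx)
                    (reflexive (cong₂ _*_ (cong D (List.filter-++ (T? ∘ c) pre xs))
                                          (cong (detL (outside rs))
                                                (≡.sym (filterᵇ-insert-reject (∁ᵇ c) pre xs (cong not cx)))))))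
          later′ : expandRow r (detL rs) (pre ++ x ∷ []) xs ≈ s * (Q * Z)
          later′ = trans later (reflexive (cong₂ _*_
            (cong sign (exponent-snoc-inside pre xs cx))
            (cong₂ _*_ (cong (λ p → expandRow r D p (inside xs)) (filterᵇ-snoc-accept c pre cx))
                       (outerMinor-snoc pre x xs))))

        -- an outside column x: M r x ≈ 0, and x moves into pre, flipping the sign
        expanded-outside : ∀ pre {x} xs → c x ≡ false →
          Expanded (pre ++ x ∷ []) xs → Expanded pre (x ∷ xs)
        expanded-outside pre {x} xs cx later = begin
          expandRow r (detL rs) pre (x ∷ xs)
            ≡⟨ expandRow-∷ r (detL rs) pre x xs ⟩
          M r x * detL rs (pre ++ xs) + - expandRow r (detL rs) (pre ++ x ∷ []) xs
            ≈⟨ +-cong (*-congʳ (block r x r≢x)) (-‿cong later′) ⟩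
          0# * detL rs (pre ++ xs) + - (- s * (E * Z))
            ≈⟨ vanishing-first-term (detL rs (pre ++ xs)) s (E * Z) ⟩
          s * (E * Z)
            ∎
          where
          D = detL (inside rs)
          s = sign (exponent pre (x ∷ xs))
          E = expandRow r D (inside pre) (inside (x ∷ xs))
          Z = outerMinor pre (x ∷ xs)
          r≢x : c r ≢ c x
          r≢x eq with ≡.trans (≡.sym cr) (≡.trans eq cx)
          ... | ()
          later′ : expandRow r (detL rs) (pre ++ x ∷ []) xs ≈ - s * (E * Z)
          later′ = trans later (reflexive (cong₂ _*_
            (cong sign (exponent-snoc-outside pre xs cx))
            (cong₂ _*_ (cong₂ (expandRow r D) (filterᵇ-snoc-reject c pre cx) (≡.sym (filterᵇ-reject c xs cx)))
                       (outerMinor-snoc pre x xs))))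

        expanded : ∀ pre cs → suc (length rs) ≡ length (pre ++ cs) → suc (count c rs) ≡ count c (pre ++ cs) →
                   Expanded pre cs
        expanded pre []       _   _   = expanded-[] pre
        expanded pre (x ∷ xs) len cnt = by-column (c x) ≡.refl
          where
          later : Expanded (pre ++ x ∷ []) xs
          later = expanded (pre ++ x ∷ []) xs (≡.trans len (cong length (≡.sym (reassoc pre x xs))))
                                              (≡.trans cnt (cong (count c) (≡.sym (reassoc pre x xs))))
          by-column : ∀ b → c x ≡ b → Expanded pre (x ∷ xs)
          by-column true  cx = expanded-inside pre xs cx
            (ℕ.suc-injective (≡.trans len (List.length-++-sucʳ pre x xs)))
            (ℕ.suc-injective (≡.trans cnt (count-insert c pre xs cx)))
            later
          by-column false cx = expanded-outside pre xs cx later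

        -- the case pre = [] is the block factorisation for the rows r ∷ rs
        factorises : ∀ cs → length (r ∷ rs) ≡ length cs → count c (r ∷ rs) ≡ count c cs →
                     Factorises c (r ∷ rs) cs
        factorises cs len cnt rewrite cr =
          trans (expanded [] cs len cnt) (*-congʳ (reflexive (cong sign (ℕ.+-identityʳ (inversions c rs ℕ.+ inversions c cs)))))

      factorises-∁ᵇ : ∀ c rs cs → count c rs ≡ count c cs → count (∁ᵇ c) rs ≡ count (∁ᵇ c) cs →
                      Factorises (∁ᵇ c) rs cs → Factorises c rs cs
      factorises-∁ᵇ c rs cs cnt cnt′ swapped = trans swapped (*-cong signs-agree (begin
        detL (filterᵇ (∁ᵇ c) rs) (filterᵇ (∁ᵇ c) cs) * detL (filterᵇ (∁ᵇ (∁ᵇ c)) rs) (filterᵇ (∁ᵇ (∁ᵇ c)) cs)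
          ≡⟨ cong₂ (λ rs′ cs′ → detL (filterᵇ (∁ᵇ c) rs) (filterᵇ (∁ᵇ c) cs) * detL rs′ cs′)
                   (filterᵇ-∁ᵇ-∁ᵇ c rs) (filterᵇ-∁ᵇ-∁ᵇ c cs) ⟩
        detL (filterᵇ (∁ᵇ c) rs) (filterᵇ (∁ᵇ c) cs) * detL (filterᵇ c rs) (filterᵇ c cs)
          ≈⟨ *-comm _ _ ⟩
        detL (filterᵇ c rs) (filterᵇ c cs) * detL (filterᵇ (∁ᵇ c) rs) (filterᵇ (∁ᵇ c) cs) ∎))
        where
        signs-agree : sign (inversions (∁ᵇ c) rs ℕ.+ inversions (∁ᵇ c) cs) ≈ sign (inversions c rs ℕ.+ inversions c cs)
        signs-agree = sign-swap (inversions c rs) (inversions (∁ᵇ c) rs) (inversions c cs) (inversions (∁ᵇ c) cs)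
          (≡.trans (inversions-complement c rs)
                   (≡.trans (cong₂ ℕ._*_ cnt cnt′) (≡.sym (inversions-complement c cs))))

      factorises : ∀ c → BlockDiagonal c → ∀ rs cs → length rs ≡ length cs → count c rs ≡ count c cs →
                   Factorises c rs cs
      factorises c block []       []      _   _   = sym (trans (*-identityˡ _) (*-identityˡ 1#))
      factorises c block []       (_ ∷ _) ()  _
      factorises c block (r ∷ rs) cs      len cnt = by-row (c r) ≡.refl
        where
        block′ : BlockDiagonal (∁ᵇ c)
        block′ x y ne = block x y (ne ∘ cong not)
        cnt′ : count (∁ᵇ c) (r ∷ rs) ≡ count (∁ᵇ c) cs
        cnt′ = count-∁ᵇ c (r ∷ rs) cs len cnt
        by-row : ∀ b → c r ≡ b → Factorises c (r ∷ rs) cs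
        by-row true  cr = InsideRow.factorises c block r cr rs (factorises c block rs) cs len cnt
        by-row false cr = factorises-∁ᵇ c (r ∷ rs) cs cnt cnt′
          (InsideRow.factorises (∁ᵇ c) block′ r (cong not cr) rs (factorises (∁ᵇ c) block′ rs) cs len cnt′)

      -- on the diagonal the row and column permutations coincide, so the
      -- sign cancels
      factorises-diagonal : ∀ c → BlockDiagonal c → ∀ xs →
        detL xs xs ≈ detL (filterᵇ c xs) (filterᵇ c xs) * detL (filterᵇ (∁ᵇ c) xs) (filterᵇ (∁ᵇ c) xs)
      factorises-diagonal c block xs =
        trans (factorises c block xs xs ≡.refl ≡.refl)
              (trans (*-congʳ (sign-even 0 (inversions c xs))) (*-identityˡ _))

      blockDet : List A → (A → Bool) → Carrier
      blockDet xs S = detL (filterᵇ S xs) (filterᵇ S xs)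

      det-blocks : ∀ Ss → All BlockDiagonal Ss → ∀ xs → All (InExactlyOne Ss) xs →
                   detL xs xs ≈ foldr _*_ 1# (map (blockDet xs) Ss)
      det-blocks []       []               []       []         = refl
      det-blocks []       []               (x ∷ xs) (() ∷ _)
      det-blocks (S ∷ Ss) (block ∷ blocks) xs       one        = begin
        detL xs xs                                        ≈⟨ factorises-diagonal S block xs ⟩
        blockDet xs S * detL rest rest                    ≈⟨ *-congˡ (det-blocks Ss blocks rest (inExactlyOne-rest S Ss xs one)) ⟩
        blockDet xs S * foldr _*_ 1# (map (blockDet rest) Ss) ≡⟨ cong (λ ds → blockDet xs S * foldr _*_ 1# ds)
                                                                     (List.map-cong-local (All.tabulate same-block)) ⟩
        blockDet xs S * foldr _*_ 1# (map (blockDet xs) Ss) ∎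
        where
        rest = filterᵇ (∁ᵇ S) xs
        same-block : ∀ {S′} → S′ ∈ Ss → blockDet rest S′ ≡ blockDet xs S′
        same-block {S′} S′∈Ss = cong (λ ys → detL ys ys)
          (filterᵇ-∁ᵇ-disjoint S S′ xs (All.map (λ o → inExactlyOne-∈ S Ss o S′∈Ss) one))

open import Defs

-- The exponent group ℤ^d and the ring R_d of Laurent polynomials.
module LaurentPolynomials where

  open import Level using (0ℓ)
  open import Data.Nat using (ℕ)
  open import Data.Integer as ℤ using (ℤ; +_; -_)
  import Data.Integer.Properties as ℤ
  open import Data.Integer.Tactic.RingSolver using (solve-∀)
  open import Data.Vec using ([]; _∷_)
  open import Data.Vec.Relation.Binary.Pointwise.Inductive
    using (Pointwise-≡⇒≡; zipWith-assoc; zipWith-identityˡ; zipWith-comm)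
  open import Data.List using (List; []; _∷_; _++_)
  import Data.List.Properties as List
  open import Data.Bool using (true; false; if_then_else_)
  open import Data.Product using (_×_; _,_)
  open import Relation.Nullary using (does)
  open import Relation.Nullary.Decidable using (does-⇔)
  open import Relation.Binary.PropositionalEquality
  open import Algebra.Bundles using (AbelianGroup; CommutativeRing)
  open import Function using (_⇔_; mk⇔; Equivalence)

  +ᵉ-inverseˡ : ∀ {d} (a : Exp d) → (-ᵉ a) +ᵉ a ≡ 0ᵉ
  +ᵉ-inverseˡ []      = refl
  +ᵉ-inverseˡ (x ∷ a) = cong₂ _∷_ (ℤ.+-inverseˡ x) (+ᵉ-inverseˡ a)

  module _ {d : ℕ} where

    +ᵉ-assoc : ∀ (a b c : Exp d) → (a +ᵉ b) +ᵉ c ≡ a +ᵉ (b +ᵉ c)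
    +ᵉ-assoc a b c = Pointwise-≡⇒≡ (zipWith-assoc ℤ.+-assoc a b c)

    +ᵉ-identityˡ : ∀ (a : Exp d) → 0ᵉ +ᵉ a ≡ a
    +ᵉ-identityˡ a = Pointwise-≡⇒≡ (zipWith-identityˡ ℤ.+-identityˡ a)

    +ᵉ-comm : ∀ (a b : Exp d) → a +ᵉ b ≡ b +ᵉ a
    +ᵉ-comm a b = Pointwise-≡⇒≡ (zipWith-comm ℤ.+-comm a b)

  exponentGroup : ℕ → AbelianGroup 0ℓ 0ℓ
  exponentGroup d = record
    { Carrier = Exp d ; _≈_ = _≡_ ; _∙_ = _+ᵉ_ ; ε = 0ᵉ ; _⁻¹ = -ᵉ_
    ; isAbelianGroup = record
      { isGroup = record
        { isMonoid = record
          { isSemigroup = record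
            { isMagma = record { isEquivalence = isEquivalence ; ∙-cong = cong₂ _+ᵉ_ }
            ; assoc = +ᵉ-assoc }
          ; identity = +ᵉ-identityˡ , λ a → trans (+ᵉ-comm a 0ᵉ) (+ᵉ-identityˡ a) }
        ; inverse = +ᵉ-inverseˡ , λ a → trans (+ᵉ-comm a (-ᵉ a)) (+ᵉ-inverseˡ a)
        ; ⁻¹-cong = cong -ᵉ_ }
      ; comm = +ᵉ-comm } }

  infixl 6 _-ᵉ_
  _-ᵉ_ : ∀ {d} → Exp d → Exp d → Exp d
  s -ᵉ e = s +ᵉ (-ᵉ e)

  module _ {d : ℕ} where
    open AbelianGroup (exponentGroup d) using (group; comm; assoc)
    open import Algebra.Properties.Group group using (x≈z//y; //-rightDividesˡ; ε⁻¹≈ε)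
    open import Algebra.Properties.AbelianGroup (exponentGroup d) using (⁻¹-∙-comm)

    -ᵉ-solve : ∀ (e e' s : Exp d) → (e +ᵉ e' ≡ s) ⇔ (e' ≡ s -ᵉ e)
    -ᵉ-solve e e' s = mk⇔ (λ eq → x≈z//y e' e s (trans (comm e' e) eq))
                           (λ { refl → trans (comm e (s -ᵉ e)) (//-rightDividesˡ e s) })

    -ᵉ-swap : ∀ (e e' s : Exp d) → (e ≡ s -ᵉ e') ⇔ (e' ≡ s -ᵉ e)
    -ᵉ-swap e e' s = mk⇔ (λ eq → to (-ᵉ-solve e e' s) (trans (comm e e') (from (-ᵉ-solve e' e s) eq)))
                          (λ eq → to (-ᵉ-solve e' e s) (trans (comm e' e) (from (-ᵉ-solve e e' s) eq)))
      where open Equivalence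

    -ᵉ-+ᵉ : ∀ (s e e' : Exp d) → s -ᵉ (e +ᵉ e') ≡ (s -ᵉ e) -ᵉ e'
    -ᵉ-+ᵉ s e e' = trans (cong (s +ᵉ_) (sym (⁻¹-∙-comm e e'))) (sym (assoc s (-ᵉ e) (-ᵉ e')))

    -ᵉ-0ᵉ : ∀ (s : Exp d) → s -ᵉ 0ᵉ ≡ s
    -ᵉ-0ᵉ s = trans (cong (s +ᵉ_) ε⁻¹≈ε) (trans (comm s 0ᵉ) (+ᵉ-identityˡ s))

    -ᵉ-cancel : ∀ (t s : Exp d) → (t -ᵉ s) +ᵉ s ≡ t
    -ᵉ-cancel t s = //-rightDividesˡ s t

  -- Equality of LP d is
  -- equality of all coefficients, so every ring law is proved by computing
  -- coefficients; products are handled by the convolution formula below.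
  module _ {d : ℕ} where

    term : ℤ → Exp d → Exp d → ℤ
    term c e s = if does (e ≟ᵉ s) then c else + 0

    term-cong : ∀ c {e s e' s' : Exp d} → (e ≡ s ⇔ e' ≡ s') → term c e s ≡ term c e' s'
    term-cong c {e} {s} {e'} {s'} e⇔e' =
      cong (if_then c else + 0) (does-⇔ e⇔e' (e ≟ᵉ s) (e' ≟ᵉ s'))

    term-* : ∀ c c' (e s : Exp d) → term (c ℤ.* c') e s ≡ c ℤ.* term c' e s
    term-* c c' e s with does (e ≟ᵉ s)
    ... | true  = refl
    ... | false = sym (ℤ.*-zeroʳ c)

    term-neg : ∀ c (e s : Exp d) → term (- c) e s ≡ - term c e s
    term-neg c e s with does (e ≟ᵉ s)
    ... | true  = refl
    ... | false = refl

    coeff-+ᴸ : ∀ (p q : LP d) s → coeff (p +ᴸ q) s ≡ coeff p s ℤ.+ coeff q s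
    coeff-+ᴸ []            q s = sym (ℤ.+-identityˡ _)
    coeff-+ᴸ ((c , e) ∷ p) q s =
      trans (cong (λ z → term c e s ℤ.+ z) (coeff-+ᴸ p q s)) (sym (ℤ.+-assoc (term c e s) _ _))

    coeff-negᴸ : ∀ (p : LP d) s → coeff (negᴸ p) s ≡ - coeff p s
    coeff-negᴸ []            s = refl
    coeff-negᴸ ((c , e) ∷ p) s =
      trans (cong₂ ℤ._+_ (term-neg c e s) (coeff-negᴸ p s)) (sym (ℤ.neg-distrib-+ (term c e s) _))

    -- convolve p f s = Σ_{c·x^e ∈ p} c · f (s - e); with f = coeff q this is
    -- the coefficient of x^s in p·q.
    convolve : LP d → (Exp d → ℤ) → Exp d → ℤ
    convolve []            f s = + 0
    convolve ((c , e) ∷ p) f s = c ℤ.* f (s -ᵉ e) ℤ.+ convolve p f s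

    convolve-cong : ∀ (p : LP d) {f g : Exp d → ℤ} → (∀ t → f t ≡ g t) →
                    ∀ s → convolve p f s ≡ convolve p g s
    convolve-cong []            f≗g s = refl
    convolve-cong ((c , e) ∷ p) f≗g s = cong₂ ℤ._+_ (cong (c ℤ.*_) (f≗g _)) (convolve-cong p f≗g s)

    convolve-0 : ∀ (p : LP d) s → convolve p (λ _ → + 0) s ≡ + 0
    convolve-0 []            s = refl
    convolve-0 ((c , e) ∷ p) s =
      trans (cong (ℤ._+ convolve p _ s) (ℤ.*-zeroʳ c)) (trans (ℤ.+-identityˡ _) (convolve-0 p s))

    convolve-+ : ∀ (p : LP d) (f g : Exp d → ℤ) s →
                 convolve p (λ t → f t ℤ.+ g t) s ≡ convolve p f s ℤ.+ convolve p g s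
    convolve-+ []            f g s = refl
    convolve-+ ((c , e) ∷ p) f g s =
      trans (cong (λ z → c ℤ.* (f (s -ᵉ e) ℤ.+ g (s -ᵉ e)) ℤ.+ z) (convolve-+ p f g s))
            (regroup c (f _) (g _) (convolve p f s) (convolve p g s))
      where
      regroup : ∀ c a b F G → c ℤ.* (a ℤ.+ b) ℤ.+ (F ℤ.+ G) ≡ (c ℤ.* a ℤ.+ F) ℤ.+ (c ℤ.* b ℤ.+ G)
      regroup = solve-∀

    convolve-+ᴸ : ∀ (p q : LP d) f s → convolve (p +ᴸ q) f s ≡ convolve p f s ℤ.+ convolve q f s
    convolve-+ᴸ []            q f s = sym (ℤ.+-identityˡ _)
    convolve-+ᴸ ((c , e) ∷ p) q f s =
      trans (cong (λ z → c ℤ.* f (s -ᵉ e) ℤ.+ z) (convolve-+ᴸ p q f s)) (sym (ℤ.+-assoc (c ℤ.* f (s -ᵉ e)) (convolve p f s) (convolve q f s)))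

    *ᴸ-∷ : ∀ (t : ℤ × Exp d) (p q : LP d) → (t ∷ p) *ᴸ q ≡ ((t ∷ []) *ᴸ q) +ᴸ (p *ᴸ q)
    *ᴸ-∷ t p q = cong (_+ᴸ (p *ᴸ q)) (sym (List.++-identityʳ _))

    coeff-term-*ᴸ : ∀ c (e : Exp d) q s → coeff (((c , e) ∷ []) *ᴸ q) s ≡ c ℤ.* coeff q (s -ᵉ e)
    coeff-term-*ᴸ c e []              s = sym (ℤ.*-zeroʳ c)
    coeff-term-*ᴸ c e ((c' , e') ∷ q) s =
      trans (cong₂ ℤ._+_ (trans (term-cong (c ℤ.* c') (-ᵉ-solve e e' s)) (term-* c c' e' (s -ᵉ e)))
                         (coeff-term-*ᴸ c e q s))
            (sym (ℤ.*-distribˡ-+ c _ _))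

    coeff-*ᴸ : ∀ (p q : LP d) s → coeff (p *ᴸ q) s ≡ convolve p (coeff q) s
    coeff-*ᴸ []            q s = refl
    coeff-*ᴸ ((c , e) ∷ p) q s =
      trans (cong (λ r → coeff r s) (*ᴸ-∷ (c , e) p q))
            (trans (coeff-+ᴸ (((c , e) ∷ []) *ᴸ q) (p *ᴸ q) s)
                   (cong₂ ℤ._+_ (coeff-term-*ᴸ c e q s) (coeff-*ᴸ p q s)))

    convolve-term-*ᴸ : ∀ c (e : Exp d) q f s →
                       convolve (((c , e) ∷ []) *ᴸ q) f s ≡ c ℤ.* convolve q f (s -ᵉ e)
    convolve-term-*ᴸ c e []              f s = sym (ℤ.*-zeroʳ c)
    convolve-term-*ᴸ c e ((c' , e') ∷ q) f s =
      trans (cong₂ ℤ._+_ (trans (cong (λ t → c ℤ.* c' ℤ.* f t) (-ᵉ-+ᵉ s e e')) (ℤ.*-assoc c c' _))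
                         (convolve-term-*ᴸ c e q f s))
            (sym (ℤ.*-distribˡ-+ c _ _))

    -- convolution with a product is iterated convolution (associativity)
    convolve-*ᴸ : ∀ (p q : LP d) f s → convolve (p *ᴸ q) f s ≡ convolve p (convolve q f) s
    convolve-*ᴸ []            q f s = refl
    convolve-*ᴸ ((c , e) ∷ p) q f s =
      trans (cong (λ r → convolve r f s) (*ᴸ-∷ (c , e) p q))
            (trans (convolve-+ᴸ (((c , e) ∷ []) *ᴸ q) (p *ᴸ q) f s)
                   (cong₂ ℤ._+_ (convolve-term-*ᴸ c e q f s) (convolve-*ᴸ p q f s)))

    convolve-term : ∀ (q : LP d) c (e : Exp d) s →
                    convolve q (term c e) s ≡ c ℤ.* coeff q (s -ᵉ e)
    convolve-term []              c e s = sym (ℤ.*-zeroʳ c)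
    convolve-term ((c' , e') ∷ q) c e s =
      trans (cong₂ ℤ._+_ (trans (cong (c' ℤ.*_) (term-cong c (-ᵉ-swap e e' s)))
                                (trans (sym (term-* c' c e' (s -ᵉ e)))
                                       (trans (cong (λ k → term k e' (s -ᵉ e)) (ℤ.*-comm c' c))
                                              (term-* c c' e' (s -ᵉ e)))))
                         (convolve-term q c e s))
            (sym (ℤ.*-distribˡ-+ c _ _))

    -- convolution of coefficient functions is symmetric (commutativity)
    convolve-comm : ∀ (p q : LP d) s → convolve p (coeff q) s ≡ convolve q (coeff p) s
    convolve-comm []            q s = sym (convolve-0 q s)
    convolve-comm ((c , e) ∷ p) q s =
      sym (trans (convolve-+ q (term c e) (coeff p) s)
                 (cong₂ ℤ._+_ (convolve-term q c e s) (sym (convolve-comm p q s))))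

    +ᴸ-cong : ∀ {p p' q q' : LP d} → p ≈ p' → q ≈ q' → p +ᴸ q ≈ p' +ᴸ q'
    +ᴸ-cong {p} {p'} {q} {q'} p≈p' q≈q' s =
      trans (coeff-+ᴸ p q s) (trans (cong₂ ℤ._+_ (p≈p' s) (q≈q' s)) (sym (coeff-+ᴸ p' q' s)))

    +ᴸ-assoc : ∀ (p q r : LP d) → (p +ᴸ q) +ᴸ r ≈ p +ᴸ (q +ᴸ r)
    +ᴸ-assoc p q r s = cong (λ t → coeff t s) (List.++-assoc p q r)

    +ᴸ-identityʳ : ∀ (p : LP d) → p +ᴸ 0ᴸ ≈ p
    +ᴸ-identityʳ p s = cong (λ t → coeff t s) (List.++-identityʳ p)

    +ᴸ-comm : ∀ (p q : LP d) → p +ᴸ q ≈ q +ᴸ p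
    +ᴸ-comm p q s = trans (coeff-+ᴸ p q s) (trans (ℤ.+-comm (coeff p s) _) (sym (coeff-+ᴸ q p s)))

    negᴸ-cong : ∀ {p q : LP d} → p ≈ q → negᴸ p ≈ negᴸ q
    negᴸ-cong {p} {q} p≈q s = trans (coeff-negᴸ p s) (trans (cong -_ (p≈q s)) (sym (coeff-negᴸ q s)))

    negᴸ-inverseˡ : ∀ (p : LP d) → negᴸ p +ᴸ p ≈ 0ᴸ
    negᴸ-inverseˡ p s =
      trans (coeff-+ᴸ (negᴸ p) p s)
            (trans (cong (ℤ._+ coeff p s) (coeff-negᴸ p s)) (ℤ.+-inverseˡ (coeff p s)))

    negᴸ-inverseʳ : ∀ (p : LP d) → p +ᴸ negᴸ p ≈ 0ᴸ
    negᴸ-inverseʳ p s = trans (+ᴸ-comm p (negᴸ p) s) (negᴸ-inverseˡ p s)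

    *ᴸ-comm : ∀ (p q : LP d) → p *ᴸ q ≈ q *ᴸ p
    *ᴸ-comm p q s = trans (coeff-*ᴸ p q s) (trans (convolve-comm p q s) (sym (coeff-*ᴸ q p s)))

    *ᴸ-congˡ : ∀ (p : LP d) {q q' : LP d} → q ≈ q' → p *ᴸ q ≈ p *ᴸ q'
    *ᴸ-congˡ p {q} {q'} q≈q' s =
      trans (coeff-*ᴸ p q s) (trans (convolve-cong p q≈q' s) (sym (coeff-*ᴸ p q' s)))

    *ᴸ-cong : ∀ {p p' q q' : LP d} → p ≈ p' → q ≈ q' → p *ᴸ q ≈ p' *ᴸ q'
    *ᴸ-cong {p} {p'} {q} {q'} p≈p' q≈q' s =
      trans (*ᴸ-congˡ p {q} {q'} q≈q' s)
            (trans (*ᴸ-comm p q' s) (trans (*ᴸ-congˡ q' {p} {p'} p≈p' s) (*ᴸ-comm q' p' s)))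

    *ᴸ-assoc : ∀ (p q r : LP d) → (p *ᴸ q) *ᴸ r ≈ p *ᴸ (q *ᴸ r)
    *ᴸ-assoc p q r s =
      trans (coeff-*ᴸ (p *ᴸ q) r s)
            (trans (convolve-*ᴸ p q (coeff r) s)
                   (trans (convolve-cong p (λ t → sym (coeff-*ᴸ q r t)) s)
                          (sym (coeff-*ᴸ p (q *ᴸ r) s))))

    *ᴸ-identityˡ : ∀ (p : LP d) → 1ᴸ *ᴸ p ≈ p
    *ᴸ-identityˡ p s =
      trans (coeff-*ᴸ 1ᴸ p s)
            (trans (ℤ.+-identityʳ _) (trans (ℤ.*-identityˡ _) (cong (coeff p) (-ᵉ-0ᵉ s))))

    *ᴸ-identityʳ : ∀ (p : LP d) → p *ᴸ 1ᴸ ≈ p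
    *ᴸ-identityʳ p s = trans (*ᴸ-comm p 1ᴸ s) (*ᴸ-identityˡ p s)

    *ᴸ-distribˡ : ∀ (p q r : LP d) → p *ᴸ (q +ᴸ r) ≈ (p *ᴸ q) +ᴸ (p *ᴸ r)
    *ᴸ-distribˡ p q r s =
      trans (coeff-*ᴸ p (q +ᴸ r) s)
            (trans (convolve-cong p (coeff-+ᴸ q r) s)
                   (trans (convolve-+ p (coeff q) (coeff r) s)
                          (sym (trans (coeff-+ᴸ (p *ᴸ q) (p *ᴸ r) s)
                                      (cong₂ ℤ._+_ (coeff-*ᴸ p q s) (coeff-*ᴸ p r s))))))

    *ᴸ-distribʳ : ∀ (p q r : LP d) → (q +ᴸ r) *ᴸ p ≈ (q *ᴸ p) +ᴸ (r *ᴸ p)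
    *ᴸ-distribʳ p q r s =
      trans (coeff-*ᴸ (q +ᴸ r) p s)
            (trans (convolve-+ᴸ q r (coeff p) s)
                   (sym (trans (coeff-+ᴸ (q *ᴸ p) (r *ᴸ p) s)
                               (cong₂ ℤ._+_ (coeff-*ᴸ q p s) (coeff-*ᴸ r p s)))))

  -- Coefficientwise equality packaged as a record, so that the two sides
  -- of an equation can be inferred (a bare ∀-type hides them).
  infix 4 _≋_
  record _≋_ {d} (p q : LP d) : Set where
    constructor ≋-intro
    field ≋-elim : p ≈ q
  open _≋_ public

  LaurentRing : ℕ → CommutativeRing 0ℓ 0ℓ
  LaurentRing d = record
    { Carrier = LP d ; _≈_ = _≋_ ; _+_ = _+ᴸ_ ; _*_ = _*ᴸ_ ; -_ = negᴸ ; 0# = 0ᴸ ; 1# = 1ᴸ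
    ; isCommutativeRing = record
      { isRing = record
        { +-isAbelianGroup = record
          { isGroup = record
            { isMonoid = record
              { isSemigroup = record
                { isMagma = record
                  { isEquivalence = record
                    { refl  = ≋-intro (λ s → refl)
                    ; sym   = λ p≈q → ≋-intro (λ s → sym (≋-elim p≈q s))
                    ; trans = λ p≈q q≈r → ≋-intro (λ s → trans (≋-elim p≈q s) (≋-elim q≈r s)) }
                  ; ∙-cong = λ {p} {p'} {q} {q'} p≈p' q≈q' →
                      ≋-intro (+ᴸ-cong {p = p} {p'} {q} {q'} (≋-elim p≈p') (≋-elim q≈q')) }
                ; assoc = λ p q r → ≋-intro (+ᴸ-assoc p q r) }
              ; identity = (λ p → ≋-intro (λ s → refl)) , (λ p → ≋-intro (+ᴸ-identityʳ p)) }
            ; inverse = (λ p → ≋-intro (negᴸ-inverseˡ p)) , (λ p → ≋-intro (negᴸ-inverseʳ p))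
            ; ⁻¹-cong = λ {p} {q} p≈q → ≋-intro (negᴸ-cong {p = p} {q} (≋-elim p≈q)) }
          ; comm = λ p q → ≋-intro (+ᴸ-comm p q) }
        ; *-cong = λ {p} {p'} {q} {q'} p≈p' q≈q' →
                    ≋-intro (*ᴸ-cong {p = p} {p'} {q} {q'} (≋-elim p≈p') (≋-elim q≈q'))
        ; *-assoc = λ p q r → ≋-intro (*ᴸ-assoc p q r)
        ; *-identity = (λ p → ≋-intro (*ᴸ-identityˡ p)) , (λ p → ≋-intro (*ᴸ-identityʳ p))
        ; distrib = (λ p q r → ≋-intro (*ᴸ-distribˡ p q r)) , (λ p q r → ≋-intro (*ᴸ-distribʳ p q r)) }
      ; *-comm = λ p q → ≋-intro (*ᴸ-comm p q) } }

-- Laplacians of periodic graphs and their component orbits.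
module PeriodicLaplacians where

  open LaurentPolynomials
  open BlockDeterminants
  open import Data.Nat using (ℕ; zero; suc)
  open import Data.Integer as ℤ using (ℤ; +_)
  import Data.Integer.Properties as ℤ
  open import Data.Fin using (Fin; zero; suc; punchIn)
  open import Data.Fin.Properties using () renaming (_≟_ to _≟F_)
  open import Data.List using (List; []; _∷_; _++_; map; tabulate; filterᵇ; allFin; lookup; length)
  import Data.List.Properties as List
  open import Data.Bool using (Bool; true; false; _∧_; if_then_else_; T?)
  open import Data.Bool.Properties using (T-≡; if-eta; ∧-idem)
  open import Data.Product using (∃; _×_; _,_; proj₁; proj₂)
  open import Data.Empty using (⊥; ⊥-elim)
  open import Function using (_∘_; _⇔_; mk⇔; Equivalence)
  open import Relation.Nullary using (yes; no)
  open import Relation.Nullary.Decidable using (does-⇔; dec-false)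
  open import Data.List.Membership.Propositional using (_∈_)
  open import Data.List.Membership.Propositional.Properties using (∈-lookup)
  open import Data.List.Relation.Unary.Any using (here; there)
  open import Data.List.Relation.Unary.All as All using (All; []; _∷_)
  import Data.List.Relation.Unary.All.Properties as All
  open import Data.List.Relation.Unary.Unique.Propositional using (Unique)
  open import Data.List.Relation.Unary.AllPairs using (_∷_)
  import Data.List.Relation.Unary.Unique.Propositional.Properties as Unique
  open import Algebra.Bundles using (CommutativeRing)
  open import Relation.Binary.PropositionalEquality as ≡ using (_≡_; _≢_; cong; cong₂)

  -- Defs.det (Fin-indexed, along the first row) is the list determinant of
  -- BlockDeterminants instantiated at R_d.
  module _ {d : ℕ} where
    open CommutativeRing (LaurentRing d) using (+-cong; -‿cong; *-cong)
      renaming (refl to ≋-refl; trans to ≋-trans; reflexive to ≋-reflexive)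
    open Determinant (LaurentRing d)

    altSum-cong : ∀ {k} (f g : Fin k → LP d) → (∀ j → f j ≋ g j) → altSum f ≋ altSum g
    altSum-cong {zero}  f g f≋g = ≋-refl
    altSum-cong {suc k} f g f≋g = +-cong (f≋g zero) (-‿cong (altSum-cong (f ∘ suc) (g ∘ suc) (f≋g ∘ suc)))

    alternatingSum-picks : ∀ {A : Set} {k} (g : Fin (suc k) → A) (h : A × List A → LP d) →
      alternatingSum (map h (picks (tabulate g))) ≡ altSum (λ j → h (g j , tabulate (g ∘ punchIn j)))
    alternatingSum-picks {k = zero}  g h = ≡.refl
    alternatingSum-picks {k = suc k} g h = cong (λ t → h (g zero , tabulate (g ∘ suc)) +ᴸ negᴸ t)
      (≡.trans (cong alternatingSum (≡.sym (List.map-∘ (picks (tabulate (g ∘ suc))))))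
               (alternatingSum-picks (g ∘ suc) (λ pr → h (proj₁ pr , g zero ∷ proj₂ pr))))

    det≋detL : ∀ {A : Set} {k} (N : Fin k → Fin k → LP d) (M : A → A → LP d) (f g : Fin k → A) →
               (∀ p q → N p q ≡ M (f p) (g q)) → det N ≋ Expansion.detL M (tabulate f) (tabulate g)
    det≋detL {k = zero}  N M f g N≡M = ≋-refl
    det≋detL {k = suc k} N M f g N≡M = ≋-trans
      (altSum-cong _ _ (λ j → *-cong (≋-reflexive (N≡M zero j))
        (det≋detL (λ r c → N (suc r) (punchIn j c)) M (f ∘ suc) (g ∘ punchIn j)
                  (λ r c → N≡M (suc r) (punchIn j c)))))
      (≋-reflexive (≡.sym (alternatingSum-picks g (λ pr → M (f zero) (proj₁ pr) * detL (tabulate (f ∘ suc)) (proj₂ pr)))))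
      where open Expansion M
            open CommutativeRing (LaurentRing d) using (_*_)

  ≡-from-⇔ : ∀ {x y : Bool} → (x ≡ true ⇔ y ≡ true) → x ≡ y
  ≡-from-⇔ {false} {false} _   = ≡.refl
  ≡-from-⇔ {true}  {true}  _   = ≡.refl
  ≡-from-⇔ {true}  {false} x⇔y = ≡.sym (Equivalence.to x⇔y ≡.refl)
  ≡-from-⇔ {false} {true}  x⇔y = Equivalence.from x⇔y ≡.refl

  eqF-false : ∀ {k} {i j : Fin k} → i ≢ j → eqF i j ≡ false
  eqF-false {i = i} {j} = dec-false (i ≟F j)

  eqF-∧-false : ∀ {k} (i a j b : Fin k) → (i ≡ a → j ≡ b → ⊥) → (eqF i a ∧ eqF j b) ≡ false
  eqF-∧-false i a j b ¬both with i ≟F a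
  ... | no  _   = ≡.refl
  ... | yes i≡a = eqF-false (¬both i≡a)

  lookup-injective : ∀ {A : Set} {xs : List A} → Unique xs → ∀ p q → lookup xs p ≡ lookup xs q → p ≡ q
  lookup-injective (_ ∷ _)    zero    zero    _  = ≡.refl
  lookup-injective (x∉ ∷ _)   zero    (suc q) eq = ⊥-elim (All.lookup x∉ (∈-lookup q) eq)
  lookup-injective (x∉ ∷ _)   (suc p) zero    eq = ⊥-elim (All.lookup x∉ (∈-lookup p) (≡.sym eq))
  lookup-injective (_ ∷ uniq) (suc p) (suc q) eq = cong suc (lookup-injective uniq p q eq)

  module _ {d k : ℕ} where

    Avoids : Fin k → Fin k → EdgeOrbit d k → Set
    Avoids a b (a' , b' , s) = (eqF a' a ∧ eqF b' b) ≡ false × (eqF b' a ∧ eqF a' b) ≡ false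

    Misses : Fin k → EdgeOrbit d k → Set
    Misses i (a' , b' , s) = eqF a' i ≡ false × eqF b' i ≡ false

    adj-skip : ∀ {a b} e es → Avoids a b e → adj (e ∷ es) a b ≡ adj es a b
    adj-skip {a} {b} e es (nf , nb) rewrite nf | nb = cong (_++ adj es a b) (if-eta (isLoop e))

    degree-skip : ∀ {i} e es → Misses i e → degree (e ∷ es) i ≡ degree es i
    degree-skip {i} e es (na , nb) rewrite na | nb =
      ≡.trans (cong (ℤ._+ degree es i) (if-eta (isLoop e))) (ℤ.+-identityˡ _)

    adj-none : ∀ {a b} es → (∀ {e} → e ∈ es → Avoids a b e) → adj es a b ≡ []
    adj-none []       avoid = ≡.refl
    adj-none (e ∷ es) avoid = ≡.trans (adj-skip e es (avoid (here ≡.refl))) (adj-none es (avoid ∘ there))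

    adj-filter : ∀ {a b} (P : EdgeOrbit d k → Bool) es →
                 (∀ {e} → e ∈ es → P e ≡ false → Avoids a b e) → adj (filterᵇ P es) a b ≡ adj es a b
    adj-filter P []       avoid = ≡.refl
    adj-filter P (e ∷ es) avoid with P e in Pe
    ... | true  = cong (_ ++_) (adj-filter P es (avoid ∘ there))
    ... | false = ≡.trans (adj-filter P es (avoid ∘ there)) (≡.sym (adj-skip e es (avoid (here ≡.refl) Pe)))

    degree-filter : ∀ {i} (P : EdgeOrbit d k → Bool) es →
                    (∀ {e} → e ∈ es → P e ≡ false → Misses i e) → degree (filterᵇ P es) i ≡ degree es i
    degree-filter P []       miss = ≡.refl
    degree-filter {i} P (e ∷ es) miss with P e in Pe
    ... | true  = cong (λ t → ends e ℤ.+ t) (degree-filter P es (miss ∘ there))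
      where
      ends : EdgeOrbit d k → ℤ
      ends e@(a , b , s) = if isLoop e then + 0
                           else (if eqF a i then + 1 else + 0) ℤ.+ (if eqF b i then + 1 else + 0)
    ... | false = ≡.trans (degree-filter P es (miss ∘ there)) (≡.sym (degree-skip e es (miss (here ≡.refl) Pe)))

  module ComponentOrbit {d : ℕ} (G : PGraph d) where

    laplacian : Fin (n G) → Fin (n G) → LP d
    laplacian = laplacianOn (edges G) (n G) (λ i → i)

    open Determinant (LaurentRing d) using (module Expansion)
    open Expansion laplacian using (BlockDiagonal; blockDet; detL)
    open CommutativeRing (LaurentRing d) using ()
      renaming (trans to ≋-trans; reflexive to ≋-reflexive)

    reach-snoc : ∀ {u v w} → Reach G u v → Adjacent G v w → Reach G u w
    reach-snoc here          step = there step here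
    reach-snoc (there s rch) step = there s (reach-snoc rch step)

    module _ {S : Subset (n G)} (orbit : IsComponentOrbit G S) where
      private
        i₀ = proj₁ orbit
        reached : ∀ j → S j ≡ true ⇔ (∃ λ s → Reach G (i₀ , 0ᵉ) (j , s))
        reached = proj₂ orbit

      closed : ∀ {a b s} → (a , b , s) ∈ edges G → S a ≡ S b
      closed {a} {b} {s} e∈G = ≡-from-⇔ (mk⇔ forward backward)
        where
        open Equivalence
        forward : S a ≡ true → S b ≡ true
        forward Sa with to (reached a) Sa
        ... | t , rch = from (reached b) (t +ᵉ s , reach-snoc rch (fwd t e∈G))
        backward : S b ≡ true → S a ≡ true
        backward Sb with to (reached b) Sb
        ... | t , rch = from (reached a) (t -ᵉ s , reach-snoc rch
                (≡.subst (λ t′ → Adjacent G (b , t′) (a , t -ᵉ s)) (-ᵉ-cancel t s) (bwd (t -ᵉ s) e∈G)))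

      avoids : ∀ {a b} → S a ≢ S b → ∀ {e} → e ∈ edges G → Avoids a b e
      avoids {a} {b} Sa≢Sb {a' , b' , s} e∈G =
        eqF-∧-false a' a b' b (λ { ≡.refl ≡.refl → Sa≢Sb (closed e∈G) }) ,
        eqF-∧-false b' a a' b (λ { ≡.refl ≡.refl → Sa≢Sb (≡.sym (closed e∈G)) })

      blockDiagonal : BlockDiagonal S
      blockDiagonal a b Sa≢Sb
        rewrite eqF-false {i = a} {b} (Sa≢Sb ∘ cong S)
              | adj-none {a = a} {b} (edges G) (avoids Sa≢Sb) = ≋-intro (λ s → ≡.refl)

      deleted-outside : ∀ {a b s} → (a , b , s) ∈ edges G → (S a ∧ S b) ≡ false → S a ≡ false × S b ≡ false
      deleted-outside {a} {b} e∈G SaSb = ≡.trans (closed e∈G) Sb , Sb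
        where
        Sb : S b ≡ false
        Sb = ≡.trans (≡.sym (∧-idem (S b))) (≡.trans (cong (_∧ S b) (≡.sym (closed e∈G))) SaSb)

      private
        vs : List (Fin (n G))
        vs = filterᵇ S (allFin (n G))

        in-S : ∀ p → S (lookup vs p) ≡ true
        in-S p = Equivalence.to T-≡ (All.lookup (All.all-filter (T? ∘ S) (allFin (n G))) (∈-lookup p))

        outside-≢ : ∀ {i j} → S i ≡ false → S j ≡ true → i ≢ j
        outside-≢ Si Sj ≡.refl with () ← ≡.trans (≡.sym Si) Sj

      -- the Laplacian of G_S is the S-block of the Laplacian of G; P is the
      -- edge selector used by ΔSub (which is a pattern-matching lambda there)
      sub-laplacian : ∀ (P : EdgeOrbit d (n G) → Bool) → (∀ a b s → P (a , b , s) ≡ (S a ∧ S b)) →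
        det (laplacianOn (filterᵇ P (edges G)) (length vs) (lookup vs)) ≋ blockDet (allFin (n G)) S
      sub-laplacian P P≡ =
        ≋-trans (det≋detL _ laplacian (lookup vs) (lookup vs) entries)
                (≋-reflexive (cong₂ detL (List.tabulate-lookup vs) (List.tabulate-lookup vs)))
        where
        deleted : ∀ {a b s} → (a , b , s) ∈ edges G → P (a , b , s) ≡ false → S a ≡ false × S b ≡ false
        deleted {a} {b} {s} e∈G Pe = deleted-outside e∈G (≡.trans (≡.sym (P≡ a b s)) Pe)
        misses : ∀ p {e} → e ∈ edges G → P e ≡ false → Misses (lookup vs p) e
        misses p e∈G Pe with deleted e∈G Pe
        ... | Sa , Sb = eqF-false (outside-≢ Sa (in-S p)) , eqF-false (outside-≢ Sb (in-S p))
        avoids-sub : ∀ p q {e} → e ∈ edges G → P e ≡ false → Avoids (lookup vs p) (lookup vs q) e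
        avoids-sub p q {a' , b' , s} e∈G Pe with deleted e∈G Pe
        ... | Sa , Sb = eqF-∧-false a' _ b' _ (λ a'≡ _ → outside-≢ Sa (in-S p) a'≡) ,
                        eqF-∧-false b' _ a' _ (λ b'≡ _ → outside-≢ Sb (in-S p) b'≡)
        same-position : ∀ p q → eqF p q ≡ eqF (lookup vs p) (lookup vs q)
        same-position p q = does-⇔ (mk⇔ (cong (lookup vs)) (lookup-injective uniq p q)) (p ≟F q) (lookup vs p ≟F lookup vs q)
          where
          uniq : Unique vs
          uniq = Unique.filter⁺ (T? ∘ S) (Unique.allFin⁺ (n G))
        entries : ∀ p q → laplacianOn (filterᵇ P (edges G)) (length vs) (lookup vs) p q ≡
                          laplacian (lookup vs p) (lookup vs q)
        entries p q = cong₂ (λ diagonal offDiagonal → diagonal +ᴸ negᴸ offDiagonal)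
          (cong₂ (λ δ k → if δ then const k else 0ᴸ) (same-position p q) (degree-filter P (edges G) (misses p)))
          (adj-filter P (edges G) (avoids-sub p q))

      ΔSub≋blockDet : ΔSub G S ≋ blockDet (allFin (n G)) S
      ΔSub≋blockDet = sub-laplacian _ (λ a b s → ≡.refl)

  Δ-factorises : ∀ {d} (G : PGraph d) (Gs : List (Subset (n G))) →
                 IsComponentOrbitList G Gs → Δ G ≋ productᴸ (map (ΔSub G) Gs)
  Δ-factorises {d} G Gs (orbits , inExactlyOne) = begin
    Δ G                                   ≈⟨ det≋detL _ laplacian (λ i → i) (λ i → i) (λ _ _ → ≡.refl) ⟩
    detL vertices vertices                ≈⟨ det-blocks Gs (All.map blockDiagonal orbits) vertices
                                                        (All.tabulate (λ {i} _ → inExactlyOne i)) ⟩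
    productᴸ (map (blockDet vertices) Gs) ≈⟨ product-cong Gs (All.map ΔSub≋blockDet orbits) ⟨
    productᴸ (map (ΔSub G) Gs)            ∎
    where
    open ComponentOrbit G using (laplacian; blockDiagonal; ΔSub≋blockDet)
    open CommutativeRing (LaurentRing d) using (setoid)
    open Determinant (LaurentRing d) using (product-cong; module Expansion)
    open Expansion laplacian using (detL; det-blocks; blockDet)
    open import Relation.Binary.Reasoning.Setoid setoid
    vertices = allFin (n G)

open import Relation.Binary.PropositionalEquality using (trans; sym)
open LaurentPolynomials using (≋-elim; *ᴸ-identityˡ)
open PeriodicLaplacians using (Δ-factorises)

proposition3p2 : ∀ {d} (G : PGraph d) (Gs : List (Subset (n G))) →
    IsComponentOrbitList G Gs →
    Σ (LP d) λ u → IsUnit u × (Δ G ≈ u *ᴸ productᴸ (map (ΔSub G) Gs))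
proposition3p2 G Gs orbitList =
  1ᴸ , (1ᴸ , *ᴸ-identityˡ 1ᴸ) ,
  λ s → trans (≋-elim (Δ-factorises G Gs orbitList) s) (sym (*ᴸ-identityˡ (productᴸ (map (ΔSub G) Gs)) s))
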